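{- Let $p\ge 1$ be an integer and let $a,b$ be integers with $1\le a<b\le \lfloor\frac{5p-1}{2}\rfloor$ and $a\not\equiv 0 \pmod 5$, $b\not\equiv 0\pmod 5$. Then the circulant graph $C_{5p}(a,b)$ is Type I, i.e. its total chromatic number equals $5$.
   Context: For integers $n$ and $1\le d_1<d_2<\dots<d_l\le\lfloor n/2\rfloor$, the circulant graph $C_n(d_1,\dots,d_l)$ has vertex set $\{0,1,\dots,n-1\}$, with $x$ and $y$ adjacent iff $x\equiv y\pm d_i \pmod n$ for some $i$. The paper considers four-regular circulant graphs $C_n(a,b)$ with $1\le a<b\le\lfloor\frac{n-1}{2}\rfloor$. A total coloring of a graph $G$ assigns colors to vertices and edges so that adjacent vertices receive different colors, adjacent (incident-to-a-common-vertex) edges receive different colors, and each edge receives a color different from its two endpoints. The total chromatic number $\chi''(G)$ is the minimum number of colors in a total coloring; always $\chi''(G)\ge\Delta(G)+1$. A graph is Type I if $\chi''(G)=\Delta(G)+1$. -}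

module Defs where

open import Data.Nat using (ℕ; _≤_)
open import Data.Fin using (Fin)
open import Data.Fin as F using ()
open import Data.Integer using (ℤ; +_; _-_; _+_)
open import Data.Integer.Divisibility using (_∣_)
open import Data.List using (List)
open import Data.List.Relation.Unary.Any using (Any)
open import Data.Product using (Σ; _×_; ∃)
open import Data.Sum using (_⊎_)
open import Relation.Binary.PropositionalEquality using (_≡_; _≢_)

Graph : ℕ → Set₁
Graph n = Fin n → Fin n → Set

Circulant : (n : ℕ) → List ℕ → Graph n
Circulant n ds x y =
  Any (λ d → ((+ n) ∣ ((+ F.toℕ y) - (+ F.toℕ x) - (+ d)))
           ⊎ ((+ n) ∣ ((+ F.toℕ y) - (+ F.toℕ x) + (+ d)))) ds

-- The edge colour function is given on ordered pairs and is required to be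
-- symmetric on edges; its values on non-adjacent pairs are irrelevant.
record TotalColoring {n : ℕ} (G : Graph n) (k : ℕ) : Set where
  field
    vcol : Fin n → Fin k
    ecol : Fin n → Fin n → Fin k
    ecol-sym  : ∀ {x y} → G x y → ecol x y ≡ ecol y x
    vert-prop : ∀ {x y} → G x y → vcol x ≢ vcol y
    edge-prop : ∀ {x y z} → G x y → G x z → y ≢ z → ecol x y ≢ ecol x z
    inc-prop  : ∀ {x y} → G x y → ecol x y ≢ vcol x × ecol x y ≢ vcol y

TotalChromaticNumber : {n : ℕ} → Graph n → ℕ → Set
TotalChromaticNumber G k = TotalColoring G k × (∀ m → TotalColoring G m → k ≤ m)

module Submission where

-- Colour each vertex x by x mod 5 and each edge {x, y} by 3(x + y) + t mod 5, where the
-- twist t depends only on whether the edge is an a-edge or a b-edge. Since 5 ∣ n, an edge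
-- leaving a vertex of residue X by the jump ±d reaches residue X ± d and gets colour
-- X ± 3d + t; the four edges at X therefore get X plus the offsets ±3a + tₐ, ±3b + t_b,
-- which must be distinct and avoid 0 and the corresponding ±d. For b ≢ ±a (mod 5) the
-- twists are 0 and the offsets are the four nonzero residues; for b ≡ ±a the choice
-- tₐ = a, t_b = −a turns them into {a, 2a, 3a, 4a}. Because 0 < a < b < n/2 the four neighbours of a vertex are distinct and
-- the jump of an edge is determined by its endpoints, so the residue facts lift to C_n(a,b).
-- Five colours are necessary since a vertex and its four edges are pairwise in conflict.

open import Defs
open import Data.Nat using (ℕ; _≤_; _<_; _*_; _∸_; _/_)
open import Data.Nat.Divisibility using (_∣_)
open import Data.List using (_∷_; [])
open import Relation.Nullary using (¬_)

open import Data.Bool using (if_then_else_; _∨_)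
open import Data.Fin as Fin using (Fin; zero; suc; toℕ; fromℕ<)
open import Data.Fin.Properties using (toℕ-fromℕ<; toℕ-injective; toℕ<n; injective⇒≤; all?)
open import Data.Integer as ℤ using (ℤ; +_; -_; _-_; 0ℤ; ∣_∣; _⊖_)
open import Data.Integer.Properties
  using ( ∣i∣≡0⇒i≡0; ∣-i∣≡∣i∣; ∣i-j∣≤∣i∣+∣j∣; ∣m⊖n∣≡∣n⊖m∣; ∣m⊝n∣≤m⊔n; ∣⊖∣-≤; m-n≡m⊖n
        ; i-j≡0⇒i≡j; neg-involutive; neg-injective; +-injective )
open import Data.Integer.Divisibility.Signed as ℤ∣ using (∣ᵤ⇒∣; ∣⇒∣ᵤ; ∣m∣n⇒∣m-n; ∣m⇒∣-m; ∣-trans)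
open import Data.Integer.Tactic.RingSolver using (solve-∀)
open import Data.Nat as ℕ using (suc; z≤n; s≤s; _+_; _%_; _≡ᵇ_; NonZero)
open import Data.Nat.Properties
  using ( _≟_; allUpTo?; ≤-total; ≤-refl; ≤-trans; ≤-<-trans; <-trans; <⇒≤; <⇒≢; ⊔-lub
        ; m≤m+n; +-comm; +-identityʳ; *-comm; +-mono-≤; *-monoˡ-≤; m+[n∸m]≡n; m∸n+n≡m; ∸-monoʳ-<
        ; module ≤-Reasoning )
open import Data.Nat.Divisibility using (_∣0; >⇒∤; m%n≡0⇒n∣m; m∣m*n)
open import Data.Nat.DivMod using (m%n<n; %-distribˡ-+; %-remove-+ʳ; m/n*n≤m)
open import Data.List.Relation.Unary.Any using (here; there)
open import Data.Product using (Σ; _×_; _,_; proj₁; proj₂)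
open import Data.Sum using (_⊎_; inj₁; inj₂)
open import Function.Base using (_∘_)
open import Function.Definitions using (Injective)
open import Relation.Binary.PropositionalEquality
  using (_≡_; _≢_; refl; sym; trans; cong; cong₂; subst; subst₂; module ≡-Reasoning)
open import Relation.Nullary using (Dec; yes; no; ¬?; contradiction)
open import Relation.Nullary.Decidable using (map′; _×-dec_; _→-dec_; _⊎-dec_; toWitness)
open import Relation.Unary using (Decidable)

module _ {n k : ℕ} {G : Graph n} (C : TotalColoring G k) where
  open TotalColoring C

  1+degree≤colours : ∀ {d} (x : Fin n) (nb : Fin d → Fin n) → Injective _≡_ _≡_ nb →
                     (∀ i → G x (nb i)) → suc d ≤ k
  1+degree≤colours {d} x nb nb-injective x~nb = injective⇒≤ colours-injective
    where
    colours : Fin (suc d) → Fin k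
    colours zero    = vcol x
    colours (suc i) = ecol x (nb i)

    colours-injective : Injective _≡_ _≡_ colours
    colours-injective {zero}  {zero}  _ = refl
    colours-injective {zero}  {suc j} e = contradiction (sym e) (proj₁ (inc-prop (x~nb j)))
    colours-injective {suc i} {zero}  e = contradiction e (proj₁ (inc-prop (x~nb i)))
    colours-injective {suc i} {suc j} e with i Fin.≟ j
    ... | yes i≡j = cong suc i≡j
    ... | no  i≢j = contradiction e (edge-prop (x~nb i) (x~nb j) (i≢j ∘ nb-injective))

≢-via-toℕ : ∀ {k} {c d : Fin k} {m o} → toℕ c ≡ m → toℕ d ≡ o → m ≢ o → c ≢ d
≢-via-toℕ c≡m d≡o m≢o c≡d = m≢o (trans (sym c≡m) (trans (cong toℕ c≡d) d≡o))

small-multiple≡0 : ∀ {n m} → n ∣ m → m < n → m ≡ 0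
small-multiple≡0 {m = ℕ.zero} _   _   = refl
small-multiple≡0 {m = suc _}  n∣m m<n = contradiction n∣m (>⇒∤ m<n)

∣∧∣i∣<n⇒i≡0 : ∀ {n i} → + n ℤ∣.∣ i → ∣ i ∣ < n → i ≡ 0ℤ
∣∧∣i∣<n⇒i≡0 n∣i ∣i∣<n = ∣i∣≡0⇒i≡0 (small-multiple≡0 (∣⇒∣ᵤ n∣i) ∣i∣<n)

∣m-o∣∧<⇒≡ : ∀ {n m o} → + n ℤ∣.∣ + m - + o → m < n → o < n → m ≡ o
∣m-o∣∧<⇒≡ {n} {m} {o} n∣m-o m<n o<n =
  +-injective (i-j≡0⇒i≡j (+ m) (+ o) (∣∧∣i∣<n⇒i≡0 n∣m-o ∣m-o∣<n))
  where
  ∣m-o∣<n : ∣ + m - + o ∣ < n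
  ∣m-o∣<n = subst (_< n) (cong ∣_∣ (sym (m-n≡m⊖n m o)))
                  (≤-<-trans (∣m⊝n∣≤m⊔n m o) (⊔-lub m<n o<n))

∣m∸o⇒%≡ : ∀ {k} .{{_ : NonZero k}} {m o} → o ≤ m → k ∣ m ∸ o → m % k ≡ o % k
∣m∸o⇒%≡ {k} {m} {o} o≤m k∣m∸o =
  trans (cong (_% k) (sym (m+[n∸m]≡n o≤m))) (%-remove-+ʳ o k∣m∸o)

∣m⊖o∣⇒%≡ : ∀ {k} .{{_ : NonZero k}} {m o} → k ∣ ∣ m ⊖ o ∣ → m % k ≡ o % k
∣m⊖o∣⇒%≡ {k} {m} {o} k∣∣m⊖o∣ with ≤-total o m
... | inj₁ o≤m = ∣m∸o⇒%≡ o≤m (subst (k ∣_) (trans (∣m⊖n∣≡∣n⊖m∣ m o) (∣⊖∣-≤ o≤m)) k∣∣m⊖o∣)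
... | inj₂ m≤o = sym (∣m∸o⇒%≡ m≤o (subst (k ∣_) (∣⊖∣-≤ m≤o) k∣∣m⊖o∣))

∣m-o∣⇒%≡ : ∀ {k} .{{_ : NonZero k}} m o → + k ℤ∣.∣ + m - + o → m % k ≡ o % k
∣m-o∣⇒%≡ {k} m o k∣m-o = ∣m⊖o∣⇒%≡ (subst (λ i → k ∣ ∣ i ∣) (m-n≡m⊖n m o) (∣⇒∣ᵤ k∣m-o))

+≢-+ : ∀ {m k} → 0 < k → + m ≢ - + k
+≢-+ {k = suc _} _ ()

i-[-m]≡i+m : ∀ i m → i - (- + m) ≡ i ℤ.+ + m
i-[-m]≡i+m i m = cong (λ j → i ℤ.+ j) (neg-involutive (+ m))

data Jump : Set where
  α β : Jump

data Step : Set where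
  fwd bwd : Jump → Step

jumpOf : Step → Jump
jumpOf (fwd j) = j
jumpOf (bwd j) = j

reverse : Step → Step
reverse (fwd j) = bwd j
reverse (bwd j) = fwd j

step : Fin 4 → Step
step zero                   = fwd α
step (suc zero)             = bwd α
step (suc (suc zero))       = fwd β
step (suc (suc (suc zero))) = bwd β

index : Step → Fin 4
index (fwd α) = zero
index (bwd α) = suc zero
index (fwd β) = suc (suc zero)
index (bwd β) = suc (suc (suc zero))

index-step : ∀ i → index (step i) ≡ i
index-step zero                   = refl
index-step (suc zero)             = refl
index-step (suc (suc zero))       = refl
index-step (suc (suc (suc zero))) = refl

step-index : ∀ s → step (index s) ≡ s
step-index (fwd α) = refl
step-index (bwd α) = refl
step-index (fwd β) = refl
step-index (bwd β) = refl

step-injective : Injective _≡_ _≡_ step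
step-injective {i} {j} e = trans (sym (index-step i)) (trans (cong index e) (index-step j))

index-injective : Injective _≡_ _≡_ index
index-injective {s} {t} e = trans (sym (step-index s)) (trans (cong step e) (step-index t))

_≟ˢ_ : (s t : Step) → Dec (s ≡ t)
s ≟ˢ t = map′ index-injective (cong index) (index s Fin.≟ index t)

allSteps? : ∀ {P : Step → Set} → Decidable P → Dec (∀ s → P s)
allSteps? {P} P? = map′ (λ h s → subst P (step-index s) (h (index s))) (λ h i → h (step i)) (all? (P? ∘ step))

module CirculantSteps {n a b : ℕ} (0<a : 0 < a) (a<b : a < b) (b+b<n : b + b < n) where

  length : Jump → ℕ
  length α = a
  length β = b

  jump : Step → ℤ
  jump (fwd j) = + length j
  jump (bwd j) = - + length j

  data Joins (s : Step) (x y : ℕ) : Set where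
    joins : + n ℤ∣.∣ (+ y - + x) - jump s → Joins s x y

  0<length : ∀ j → 0 < length j
  0<length α = 0<a
  0<length β = <-trans 0<a a<b

  length≤b : ∀ j → length j ≤ b
  length≤b α = <⇒≤ a<b
  length≤b β = ≤-refl

  length-injective : ∀ {i j} → length i ≡ length j → i ≡ j
  length-injective {α} {α} _   = refl
  length-injective {β} {β} _   = refl
  length-injective {α} {β} a≡b = contradiction a≡b (<⇒≢ a<b)
  length-injective {β} {α} b≡a = contradiction (sym b≡a) (<⇒≢ a<b)

  ∣jump∣≤b : ∀ s → ∣ jump s ∣ ≤ b
  ∣jump∣≤b (fwd j) = length≤b j
  ∣jump∣≤b (bwd j) = subst (_≤ b) (sym (∣-i∣≡∣i∣ (+ length j))) (length≤b j)

  jump-injective : ∀ {s t} → jump s ≡ jump t → s ≡ t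
  jump-injective {fwd i} {fwd j} e = cong fwd (length-injective (+-injective e))
  jump-injective {bwd i} {bwd j} e = cong bwd (length-injective (+-injective (neg-injective e)))
  jump-injective {fwd i} {bwd j} e = contradiction e (+≢-+ (0<length j))
  jump-injective {bwd i} {fwd j} e = contradiction (sym e) (+≢-+ (0<length i))

  jump-reverse : ∀ s → jump (reverse s) ≡ - jump s
  jump-reverse (fwd j) = refl
  jump-reverse (bwd j) = sym (neg-involutive (+ length j))

  joins-functional : ∀ {s x y z} → Joins s x y → Joins s x z → y < n → z < n → y ≡ z
  joins-functional {s} {x} {y} {z} (joins xy) (joins xz) =
    ∣m-o∣∧<⇒≡ (subst (+ n ℤ∣.∣_) (cancel (+ y) (+ z) (+ x) (jump s)) (∣m∣n⇒∣m-n xy xz))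
    where
    cancel : ∀ y z x j → ((y - x) - j) - ((z - x) - j) ≡ y - z
    cancel = solve-∀

  -- The jumps ±a, ±b differ pairwise by a nonzero amount of size at most 2b < n.
  joins-injective : ∀ {s t x y} → Joins s x y → Joins t x y → s ≡ t
  joins-injective {s} {t} {x} {y} (joins xy) (joins xy′) =
    jump-injective (i-j≡0⇒i≡j (jump s) (jump t) (∣∧∣i∣<n⇒i≡0 n∣js-jt ∣js-jt∣<n))
    where
    cancel : ∀ u i j → (u - j) - (u - i) ≡ i - j
    cancel = solve-∀

    n∣js-jt : + n ℤ∣.∣ jump s - jump t
    n∣js-jt = subst (+ n ℤ∣.∣_) (cancel (+ y - + x) (jump s) (jump t)) (∣m∣n⇒∣m-n xy′ xy)

    ∣js-jt∣<n : ∣ jump s - jump t ∣ < n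
    ∣js-jt∣<n = ≤-<-trans (≤-trans (∣i-j∣≤∣i∣+∣j∣ (jump s) (jump t))
                                   (+-mono-≤ (∣jump∣≤b s) (∣jump∣≤b t)))
                          b+b<n

  joins-reverse : ∀ {s x y} → Joins s x y → Joins (reverse s) y x
  joins-reverse {s} {x} {y} (joins xy) = joins (subst (+ n ℤ∣.∣_) (sym reversed) (∣m⇒∣-m xy))
    where
    flip : ∀ x y j → (x - y) - (- j) ≡ - ((y - x) - j)
    flip = solve-∀

    reversed : (+ x - + y) - jump (reverse s) ≡ - ((+ y - + x) - jump s)
    reversed = trans (cong (λ j → (+ x - + y) - j) (jump-reverse s)) (flip (+ x) (+ y) (jump s))

  Adjacent : Fin n → Fin n → Set
  Adjacent = Circulant n (a ∷ b ∷ [])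

  bwd-joins : ∀ j {x y} → + n ℤ∣.∣ (+ y - + x) ℤ.+ + length j → Joins (bwd j) x y
  bwd-joins j {x} {y} = joins ∘ subst (+ n ℤ∣.∣_) (sym (i-[-m]≡i+m (+ y - + x) (length j)))

  bwd-joins⁻¹ : ∀ {j x y} → Joins (bwd j) x y → + n ℤ∣.∣ (+ y - + x) ℤ.+ + length j
  bwd-joins⁻¹ {j} {x} {y} (joins xy) = subst (+ n ℤ∣.∣_) (i-[-m]≡i+m (+ y - + x) (length j)) xy

  adjacent⇒joins : ∀ x y → Adjacent x y → Σ Step λ s → Joins s (toℕ x) (toℕ y)
  adjacent⇒joins _ _ (here (inj₁ xy))         = fwd α , joins (∣ᵤ⇒∣ xy)
  adjacent⇒joins _ _ (here (inj₂ xy))         = bwd α , bwd-joins α (∣ᵤ⇒∣ xy)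
  adjacent⇒joins _ _ (there (here (inj₁ xy))) = fwd β , joins (∣ᵤ⇒∣ xy)
  adjacent⇒joins _ _ (there (here (inj₂ xy))) = bwd β , bwd-joins β (∣ᵤ⇒∣ xy)

  joins⇒adjacent : ∀ {s x y} → Joins s (toℕ x) (toℕ y) → Adjacent x y
  joins⇒adjacent {fwd α} (joins xy) = here (inj₁ (∣⇒∣ᵤ xy))
  joins⇒adjacent {bwd α} xy         = here (inj₂ (∣⇒∣ᵤ (bwd-joins⁻¹ xy)))
  joins⇒adjacent {fwd β} (joins xy) = there (here (inj₁ (∣⇒∣ᵤ xy)))
  joins⇒adjacent {bwd β} xy         = there (here (inj₂ (∣⇒∣ᵤ (bwd-joins⁻¹ xy))))

  offset : Step → ℕ
  offset (fwd j) = length j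
  offset (bwd j) = n ∸ length j

  offset<n : ∀ s → offset s < n
  offset<n (fwd j) = ≤-<-trans (length≤b j) (≤-<-trans (m≤m+n b b) b+b<n)
  offset<n (bwd j) = ∸-monoʳ-< (0<length j) (<⇒≤ (offset<n (fwd j)))

  joins-offset : ∀ s → Joins s 0 (offset s)
  joins-offset (fwd j) = joins (subst (+ n ℤ∣.∣_) (sym (cancel (+ length j))) (∣ᵤ⇒∣ (n ∣0)))
    where
    cancel : ∀ i → (i - + 0) - i ≡ 0ℤ
    cancel = solve-∀
  joins-offset (bwd j) = bwd-joins j (subst (+ n ℤ∣.∣_) (sym n∸d+d≡n) ℤ∣.∣-refl)
    where
    cancel : ∀ i k → (i - + 0) ℤ.+ k ≡ i ℤ.+ k
    cancel = solve-∀

    n∸d+d≡n : (+ (n ∸ length j) - + 0) ℤ.+ + length j ≡ + n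
    n∸d+d≡n = trans (cancel (+ (n ∸ length j)) (+ length j))
                    (cong +_ (m∸n+n≡m (<⇒≤ (offset<n (fwd j)))))

  origin : Fin n
  origin = fromℕ< (≤-<-trans z≤n b+b<n)

  neighbour : Step → Fin n
  neighbour s = fromℕ< (offset<n s)

  joins-neighbour : ∀ s → Joins s (toℕ origin) (toℕ (neighbour s))
  joins-neighbour s = subst₂ (Joins s) (sym (toℕ-fromℕ< _)) (sym (toℕ-fromℕ< _)) (joins-offset s)

  neighbour-injective : Injective _≡_ _≡_ neighbour
  neighbour-injective {s} {t} e =
    joins-injective (joins-neighbour s) (subst (λ y → Joins t (toℕ origin) (toℕ y)) (sym e) (joins-neighbour t))

  5≤colours : ∀ {k} → TotalColoring Adjacent k → 5 ≤ k
  5≤colours C = 1+degree≤colours C origin (neighbour ∘ step) (step-injective ∘ neighbour-injective)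
                                 (λ i → joins⇒adjacent (joins-neighbour (step i)))

module Residues (A B : ℕ) where

  residue : Jump → ℕ
  residue α = A
  residue β = B

  Moves : Step → ℕ → ℕ → Set
  Moves (fwd j) X Y = Y ≡ (X + residue j) % 5
  Moves (bwd j) X Y = X ≡ (Y + residue j) % 5

  moves? : ∀ s X Y → Dec (Moves s X Y)
  moves? (fwd j) X Y = Y ≟ (X + residue j) % 5
  moves? (bwd j) X Y = X ≟ (Y + residue j) % 5

  twist : Jump → ℕ
  twist j = if (A ≡ᵇ B) ∨ (A + B ≡ᵇ 5) then twist′ j else 0
    where
    twist′ : Jump → ℕ
    twist′ α = A
    twist′ β = 5 ∸ A

  colour : Jump → ℕ → ℕ → ℕ
  colour j X Y = (3 * (X + Y) + twist j) % 5

  ProperEdge : Jump → ℕ → ℕ → Set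
  ProperEdge j X Y = X ≢ Y × colour j X Y ≢ X × colour j X Y ≢ Y

  properEdge? : ∀ j X Y → Dec (ProperEdge j X Y)
  properEdge? j X Y = ¬? (X ≟ Y) ×-dec ¬? (colour j X Y ≟ X) ×-dec ¬? (colour j X Y ≟ Y)

  ProperMove : ℕ → ℕ → Step → Set
  ProperMove X Y s = Moves s X Y → ProperEdge (jumpOf s) X Y

  properMove? : ∀ X Y s → Dec (ProperMove X Y s)
  properMove? X Y s = moves? s X Y →-dec properEdge? (jumpOf s) X Y

  DistinctlyColoured : ℕ → ℕ → ℕ → Step → Step → Set
  DistinctlyColoured X Y Z s t =
    s ≢ t → Moves s X Y → Moves t X Z → colour (jumpOf s) X Y ≢ colour (jumpOf t) X Z

  distinctlyColoured? : ∀ X Y Z s t → Dec (DistinctlyColoured X Y Z s t)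
  distinctlyColoured? X Y Z s t =
    ¬? (s ≟ˢ t) →-dec moves? s X Y →-dec moves? t X Z →-dec
    ¬? (colour (jumpOf s) X Y ≟ colour (jumpOf t) X Z)

moves-proper : ∀ {A} → A < 5 → A ≢ 0 → ∀ {B} → B < 5 → B ≢ 0 →
               ∀ {X} → X < 5 → ∀ {Y} → Y < 5 → ∀ s → Residues.ProperMove A B X Y s
moves-proper = toWitness {a? =
  allUpTo? (λ A → ¬? (A ≟ 0) →-dec allUpTo? (λ B → ¬? (B ≟ 0) →-dec
  allUpTo? (λ X → allUpTo? (λ Y →
  allSteps? (Residues.properMove? A B X Y)) 5) 5) 5) 5} _

moves-distinctly-coloured : ∀ {A} → A < 5 → A ≢ 0 → ∀ {B} → B < 5 → B ≢ 0 →
                            ∀ {X} → X < 5 → ∀ {Y} → Y < 5 → ∀ {Z} → Z < 5 →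
                            ∀ s t → Residues.DistinctlyColoured A B X Y Z s t
moves-distinctly-coloured = toWitness {a? =
  allUpTo? (λ A → ¬? (A ≟ 0) →-dec allUpTo? (λ B → ¬? (B ≟ 0) →-dec
  allUpTo? (λ X → allUpTo? (λ Y → allUpTo? (λ Z →
  allSteps? (λ s → allSteps? (Residues.distinctlyColoured? A B X Y Z s))) 5) 5) 5) 5) 5} _

residue≢0 : ∀ {m} → ¬ 5 ∣ m → m % 5 ≢ 0
residue≢0 {m} 5∤m m%5≡0 = 5∤m (m%n≡0⇒n∣m m 5 m%5≡0)

module FiveColouring {n a b : ℕ} (5∣n : 5 ∣ n) (0<a : 0 < a) (a<b : a < b) (b+b<n : b + b < n)
                     (5∤a : ¬ 5 ∣ a) (5∤b : ¬ 5 ∣ b) where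
  open CirculantSteps 0<a a<b b+b<n public
  open Residues (a % 5) (b % 5)

  residue-length : ∀ j → residue j ≡ length j % 5
  residue-length α = refl
  residue-length β = refl

  fwd-residue : ∀ {j x y} → Joins (fwd j) x y → y % 5 ≡ (x % 5 + residue j) % 5
  fwd-residue {j} {x} {y} (joins xy) = begin
    y % 5                      ≡⟨ ∣m-o∣⇒%≡ y (x + length j) 5∣y-[x+d] ⟩
    (x + length j) % 5         ≡⟨ %-distribˡ-+ x (length j) 5 ⟩
    (x % 5 + length j % 5) % 5 ≡⟨ cong (λ r → (x % 5 + r) % 5) (residue-length j) ⟨
    (x % 5 + residue j) % 5    ∎
    where
    open ≡-Reasoning
    regroup : ∀ y x d → (y - x) - d ≡ y - (x ℤ.+ d)
    regroup = solve-∀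

    5∣y-[x+d] : + 5 ℤ∣.∣ + y - + (x + length j)
    5∣y-[x+d] = subst (+ 5 ℤ∣.∣_) (regroup (+ y) (+ x) (+ length j)) (∣-trans (∣ᵤ⇒∣ 5∣n) xy)

  joins⇒moves : ∀ {s x y} → Joins s x y → Moves s (x % 5) (y % 5)
  joins⇒moves {fwd j} xy = fwd-residue xy
  joins⇒moves {bwd j} xy = fwd-residue (joins-reverse xy)

  joins-proper : ∀ {s x y} → Joins s x y → ProperEdge (jumpOf s) (x % 5) (y % 5)
  joins-proper {s} {x} {y} xy =
    moves-proper (m%n<n a 5) (residue≢0 5∤a) (m%n<n b 5) (residue≢0 5∤b)
                 (m%n<n x 5) (m%n<n y 5) s (joins⇒moves xy)

  IsAlong : Jump → ℕ → ℕ → Set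
  IsAlong j x y = Joins (fwd j) x y ⊎ Joins (bwd j) x y

  along-reverse : ∀ {j x y} → IsAlong j x y → IsAlong j y x
  along-reverse (inj₁ xy) = inj₂ (joins-reverse xy)
  along-reverse (inj₂ xy) = inj₁ (joins-reverse xy)

  joins? : ∀ s x y → Dec (Joins s x y)
  joins? s x y = map′ joins (λ { (joins xy) → xy }) (+ n ℤ∣.∣? _)

  along? : ∀ j x y → Dec (IsAlong j x y)
  along? j x y = joins? (fwd j) x y ⊎-dec joins? (bwd j) x y

  jumpBetween : ℕ → ℕ → Jump
  jumpBetween x y with along? α x y
  ... | yes _ = α
  ... | no  _ = β

  jumpBetween-sym : ∀ x y → jumpBetween x y ≡ jumpBetween y x
  jumpBetween-sym x y with along? α x y | along? α y x
  ... | yes _   | yes _   = refl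
  ... | no  _   | no  _   = refl
  ... | yes xy  | no  ¬yx = contradiction (along-reverse xy) ¬yx
  ... | no  ¬xy | yes yx  = contradiction (along-reverse yx) ¬xy

  jumpBetween-joins : ∀ {s x y} → Joins s x y → jumpBetween x y ≡ jumpOf s
  jumpBetween-joins {s} {x} {y} xy with along? α x y
  ... | yes (inj₁ xy′) = cong jumpOf (joins-injective xy′ xy)
  ... | yes (inj₂ xy′) = cong jumpOf (joins-injective xy′ xy)
  jumpBetween-joins {fwd α} xy | no ¬xy = contradiction (inj₁ xy) ¬xy
  jumpBetween-joins {bwd α} xy | no ¬xy = contradiction (inj₂ xy) ¬xy
  jumpBetween-joins {fwd β} xy | no _   = refl
  jumpBetween-joins {bwd β} xy | no _   = refl

  mod5 : ℕ → Fin 5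
  mod5 m = fromℕ< (m%n<n m 5)

  vertexColour : Fin n → Fin 5
  vertexColour x = mod5 (toℕ x)

  edgeColour : Fin n → Fin n → Fin 5
  edgeColour x y = mod5 (3 * (toℕ x % 5 + toℕ y % 5) + twist (jumpBetween (toℕ x) (toℕ y)))

  toℕ-vertexColour : ∀ x → toℕ (vertexColour x) ≡ toℕ x % 5
  toℕ-vertexColour x = toℕ-fromℕ< _

  toℕ-edgeColour : ∀ {s} x y → Joins s (toℕ x) (toℕ y) →
                   toℕ (edgeColour x y) ≡ colour (jumpOf s) (toℕ x % 5) (toℕ y % 5)
  toℕ-edgeColour x y xy = trans (toℕ-fromℕ< _)
    (cong (λ j → (3 * (toℕ x % 5 + toℕ y % 5) + twist j) % 5) (jumpBetween-joins xy))

  edgeColour-sym : ∀ x y → edgeColour x y ≡ edgeColour y x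
  edgeColour-sym x y = cong₂ (λ X+Y j → mod5 (3 * X+Y + twist j))
                             (+-comm (toℕ x % 5) (toℕ y % 5)) (jumpBetween-sym (toℕ x) (toℕ y))

  vertex-proper : ∀ {s} x y → Joins s (toℕ x) (toℕ y) → vertexColour x ≢ vertexColour y
  vertex-proper x y xy = ≢-via-toℕ (toℕ-vertexColour x) (toℕ-vertexColour y) (proj₁ (joins-proper xy))

  incidence-proper : ∀ {s} x y → Joins s (toℕ x) (toℕ y) →
                     edgeColour x y ≢ vertexColour x × edgeColour x y ≢ vertexColour y
  incidence-proper x y xy =
      ≢-via-toℕ (toℕ-edgeColour x y xy) (toℕ-vertexColour x) (proj₁ (proj₂ (joins-proper xy)))
    , ≢-via-toℕ (toℕ-edgeColour x y xy) (toℕ-vertexColour y) (proj₂ (proj₂ (joins-proper xy)))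

  edge-proper : ∀ {s t} x y z → Joins s (toℕ x) (toℕ y) → Joins t (toℕ x) (toℕ z) → y ≢ z →
                edgeColour x y ≢ edgeColour x z
  edge-proper {s} {t} x y z xy xz y≢z with s ≟ˢ t
  ... | yes refl = contradiction (toℕ-injective (joins-functional xy xz (toℕ<n y) (toℕ<n z))) y≢z
  ... | no  s≢t  = ≢-via-toℕ (toℕ-edgeColour x y xy) (toℕ-edgeColour x z xz)
    (moves-distinctly-coloured (m%n<n a 5) (residue≢0 5∤a) (m%n<n b 5) (residue≢0 5∤b)
                               (m%n<n (toℕ x) 5) (m%n<n (toℕ y) 5) (m%n<n (toℕ z) 5)
                               s t s≢t (joins⇒moves xy) (joins⇒moves xz))

  colouring : TotalColoring Adjacent 5
  colouring = record
    { vcol      = vertexColour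
    ; ecol      = edgeColour
    ; ecol-sym  = λ {x} {y} _ → edgeColour-sym x y
    ; vert-prop = λ {x} {y} x~y → vertex-proper x y (step-of x y x~y)
    ; edge-prop = λ {x} {y} {z} x~y x~z → edge-proper x y z (step-of x y x~y) (step-of x z x~z)
    ; inc-prop  = λ {x} {y} x~y → incidence-proper x y (step-of x y x~y)
    }
    where
    step-of : ∀ x y → (x~y : Adjacent x y) → Joins (proj₁ (adjacent⇒joins x y x~y)) (toℕ x) (toℕ y)
    step-of x y x~y = proj₂ (adjacent⇒joins x y x~y)

b≤m/2⇒b+b≤m : ∀ {b m} → b ≤ m / 2 → b + b ≤ m
b≤m/2⇒b+b≤m {b} {m} b≤m/2 = begin
  b + b       ≡⟨ cong (λ c → b + c) (+-identityʳ b) ⟨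
  2 * b       ≡⟨ *-comm 2 b ⟩
  b * 2       ≤⟨ *-monoˡ-≤ 2 b≤m/2 ⟩
  (m / 2) * 2 ≤⟨ m/n*n≤m m 2 ⟩
  m           ∎
  where open ≤-Reasoning

theorem2p1 : (p a b : ℕ) → 1 ≤ p → 1 ≤ a → a < b → b ≤ (5 * p ∸ 1) / 2 →
    ¬ (5 ∣ a) → ¬ (5 ∣ b) →
    TotalChromaticNumber (Circulant (5 * p) (a ∷ b ∷ [])) 5
theorem2p1 (suc p) a b _ 0<a a<b b≤[5p-1]/2 5∤a 5∤b = colouring , λ _ → 5≤colours
  where
  b+b<5p : b + b < 5 * suc p
  b+b<5p = s≤s (b≤m/2⇒b+b≤m b≤[5p-1]/2)

  open FiveColouring (m∣m*n (suc p)) 0<a a<b b+b<5p 5∤a 5∤b
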